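{- Let $n$ be a composite integer which is not the square of a prime, and let $n=p_1^{\alpha_1}p_2^{\alpha_2}\cdots p_k^{\alpha_k}$ be its prime power factorization, ordered so that $\alpha_1,\dots,\alpha_l$ are odd and $\alpha_{l+1},\dots,\alpha_k$ are even, for some $l\in\{0,1,\dots,k\}$. Then the chromatic number and clique number of $\Upsilon_n$ satisfy $$\chi(\Upsilon_n)=\omega(\Upsilon_n)=\left\lceil\tfrac{\alpha_1}{2}\right\rceil\cdots\left\lceil\tfrac{\alpha_l}{2}\right\rceil\left(\tfrac{\alpha_{l+1}}{2}+1\right)\cdots\left(\tfrac{\alpha_k}{2}+1\right)+l-1.$$
   Context: For an integer $n>1$, a proper divisor of $n$ is an integer $d$ with $1<d<n$ and $d\mid n$. The proper divisor graph $\Upsilon_n$ is the simple graph whose vertices are the proper divisors of $n$, two distinct vertices $u,v$ being adjacent iff $n\mid uv$. -}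

module Defs where

open import Data.Nat using (ℕ; zero; suc; _+_; _*_; _∸_; _^_; _≤_; _<_; ⌈_/2⌉; ⌊_/2⌋)
open import Data.Nat.Divisibility using (_∣_)
open import Data.Nat.Primality using (Prime)
open import Data.Bool using (Bool; true; false; if_then_else_; not)
open import Data.Bool.Properties using () renaming (_≟_ to _≟ᵇ_)
open import Data.Fin using (Fin)
open import Data.List using (List; []; _∷_; map; length; filter)
open import Data.Nat.ListAction using (product)
open import Data.List.Relation.Unary.All using (All)
open import Data.List.Relation.Unary.AllPairs using (AllPairs)
open import Data.List.Relation.Unary.Unique.Propositional using (Unique)
open import Data.Product using (_×_; _,_; proj₁; proj₂; Σ)
open import Relation.Binary.PropositionalEquality using (_≡_; _≢_)
open import Relation.Nullary using (¬_)

ProperDivisor : ℕ → ℕ → Set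
ProperDivisor n d = (1 < d) × (d < n) × (d ∣ n)

Adj : ℕ → ℕ → ℕ → Set
Adj n u v = (u ≢ v) × (n ∣ u * v)

IsClique : ℕ → List ℕ → Set
IsClique n vs = All (ProperDivisor n) vs × Unique vs × AllPairs (Adj n) vs

IsCliqueNumber : ℕ → ℕ → Set
IsCliqueNumber n ω =
  Σ (List ℕ) (λ vs → IsClique n vs × length vs ≡ ω)
  × (∀ (vs : List ℕ) → IsClique n vs → length vs ≤ ω)

IsProperColouring : ℕ → (k : ℕ) → (ℕ → Fin k) → Set
IsProperColouring n k c =
  ∀ u v → ProperDivisor n u → ProperDivisor n v → Adj n u v → c u ≢ c v

Colourable : ℕ → ℕ → Set
Colourable n k = Σ (ℕ → Fin k) (IsProperColouring n k)

IsChromaticNumber : ℕ → ℕ → Set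
IsChromaticNumber n χ = Colourable n χ × (∀ k → Colourable n k → χ ≤ k)

IsPrimeFactorization : ℕ → List (ℕ × ℕ) → Set
IsPrimeFactorization n fs =
  All (λ pa → Prime (proj₁ pa)) fs
  × All (λ pa → 1 ≤ proj₂ pa) fs
  × Unique (map proj₁ fs)
  × n ≡ product (map (λ pa → proj₁ pa ^ proj₂ pa) fs)

isOdd : ℕ → Bool
isOdd zero = false
isOdd (suc m) = not (isOdd m)

factor : ℕ → ℕ
factor α = if isOdd α then ⌈ α /2⌉ else (⌊ α /2⌋ + 1)

productPart : List (ℕ × ℕ) → ℕ
productPart fs = product (map (λ pa → factor (proj₂ pa)) fs)

numOdd : List (ℕ × ℕ) → ℕ
numOdd fs = length (filter (λ pa → isOdd (proj₂ pa) ≟ᵇ true) fs)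

-- Write n = ∏ pᵢ^αᵢ. The divisors of n are the monomials ∏ pᵢ^βᵢ with β ≤ α, and n ∣ u v exactly
-- when α ≤ β + γ, so Υₙ is a graph on exponent vectors. With h = ⌈α/2⌉ and f = ⌊α/2⌋ taken
-- componentwise, the vectors h ≤ β < α, together with the vectors obtained from α by lowering one
-- odd αᵢ to fᵢ, are pairwise adjacent: a clique with ∏ (fᵢ + 1) − 1 + l vertices, and fᵢ + 1 is the
-- paper's factor ⌈αᵢ/2⌉ or αᵢ/2 + 1. Conversely, colour a vertex β by itself if h ≤ β, and otherwise
-- by α with its first coordinate i such that βᵢ < hᵢ lowered to fᵢ. These colours are clique
-- vertices and adjacent vertices receive different ones, so χ(Υₙ) = ω(Υₙ) = the size of the clique.

module Submission where

open import Defs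
open import Data.Bool using (Bool; true; false)
open import Data.Empty using (⊥-elim)
open import Data.Fin using (Fin; zero; suc)
import Data.Fin as Fin
open import Data.Fin.Properties using (pigeonhole)
open import Data.List using (List; []; _∷_; [_]; _++_; map; length; lookup; applyUpTo; cartesianProductWith)
open import Data.List.Properties using (length-++; length-map; length-applyUpTo)
open import Data.List.Membership.Propositional using (_∈_; _∉_)
open import Data.List.Membership.Propositional.Properties
  using ( ∈-++⁺ˡ; ∈-++⁺ʳ; ∈-++⁻; ∈-map⁺; ∈-map⁻; ∈-applyUpTo⁺; ∈-applyUpTo⁻
        ; ∈-cartesianProductWith⁺; ∈-cartesianProductWith⁻; ∈-lookup)
open import Data.List.Relation.Unary.All as All using (All; []; _∷_)
import Data.List.Relation.Unary.All.Properties as All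
open import Data.List.Relation.Unary.AllPairs as AllPairs using (AllPairs; []; _∷_)
import Data.List.Relation.Unary.AllPairs.Properties as AllPairs
open import Data.List.Relation.Unary.Any using (here; there; index)
open import Data.List.Relation.Unary.Any.Properties using (lookup-index)
open import Data.List.Relation.Unary.Unique.Propositional using (Unique)
import Data.List.Relation.Unary.Unique.Propositional.Properties as Unique
open import Data.Nat
  using ( ℕ; zero; suc; _+_; _*_; _∸_; _^_; _≤_; _<_; z≤n; s≤s; _<?_; _≤?_; ⌈_/2⌉; ⌊_/2⌋
        ; NonZero; >-nonZero⁻¹; nonTrivial⇒n>1; nonTrivial⇒≢1)
open import Data.Nat.Properties
open import Data.Nat.Coprimality using (Coprime; coprime-divisor)
open import Data.Nat.Divisibility
open import Data.Nat.ListAction using (product)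
open import Data.Nat.Primality
  using (Prime; Composite; euclidsLemma; prime⇒irreducible; prime⇒nonTrivial; prime⇒nonZero)
open import Data.Nat.Tactic.RingSolver using (solve-∀)
open import Data.Product using (_×_; _,_; proj₁; proj₂; Σ; ∃₂)
import Data.Product as Product
open import Data.Sum using (_⊎_; inj₁; inj₂)
import Data.Sum as Sum
open import Data.Vec using (Vec; []; _∷_; zipWith; replicate)
import Data.Vec as Vec
open import Data.Vec.Properties using (∷-injective; ∷-injectiveˡ; ∷-injectiveʳ)
open import Data.Vec.Relation.Binary.Pointwise.Inductive as Pointwise using (Pointwise; []; _∷_)
open import Function using (_∘_)
open import Relation.Binary.PropositionalEquality
  using (_≡_; _≢_; refl; sym; trans; cong; cong₂; subst; subst₂; module ≡-Reasoning)
open import Relation.Nullary using (¬_; Dec; yes; no; _×-dec_)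

variable
  k : ℕ

⌈/2⌉-parity : ∀ a → (isOdd a ≡ true × ⌈ a /2⌉ ≡ suc ⌊ a /2⌋) ⊎ (isOdd a ≡ false × ⌈ a /2⌉ ≡ ⌊ a /2⌋)
⌈/2⌉-parity zero = inj₂ (refl , refl)
⌈/2⌉-parity (suc a) with ⌈/2⌉-parity a
... | inj₁ (odd , eq) rewrite odd = inj₂ (refl , sym eq)
... | inj₂ (even , eq) rewrite even = inj₁ (refl , cong suc (sym eq))

factor≡suc⌊/2⌋ : ∀ a → factor a ≡ suc ⌊ a /2⌋
factor≡suc⌊/2⌋ a with ⌈/2⌉-parity a
... | inj₁ (odd , eq) rewrite odd = eq
... | inj₂ (even , eq) rewrite even = +-comm ⌊ a /2⌋ 1

⌈/2⌉+⌊/2⌋≡n : ∀ a → ⌈ a /2⌉ + ⌊ a /2⌋ ≡ a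
⌈/2⌉+⌊/2⌋≡n a = trans (+-comm ⌈ a /2⌉ ⌊ a /2⌋) (⌊n/2⌋+⌈n/2⌉≡n a)

⌈/2⌉+suc⌊/2⌋≡1+n : ∀ a → ⌈ a /2⌉ + suc ⌊ a /2⌋ ≡ suc a
⌈/2⌉+suc⌊/2⌋≡1+n a = trans (+-suc ⌈ a /2⌉ ⌊ a /2⌋) (cong suc (⌈/2⌉+⌊/2⌋≡n a))

odd⇒⌊/2⌋<⌈/2⌉ : ∀ {a} → isOdd a ≡ true → ⌊ a /2⌋ < ⌈ a /2⌉
odd⇒⌊/2⌋<⌈/2⌉ {a} odd with ⌈/2⌉-parity a
... | inj₁ (_ , eq) = ≤-reflexive (sym eq)
... | inj₂ (even , _) with trans (sym odd) even
... | ()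

odd⇒⌊/2⌋< : ∀ {a} → isOdd a ≡ true → ⌊ a /2⌋ < a
odd⇒⌊/2⌋< {a} odd-a = ≤-trans (odd⇒⌊/2⌋<⌈/2⌉ odd-a) (⌈n/2⌉≤n a)

odd∧⌊/2⌋≡0⇒≡1 : ∀ {a} → isOdd a ≡ true → ⌊ a /2⌋ ≡ 0 → a ≡ 1
odd∧⌊/2⌋≡0⇒≡1 {suc zero} _ _ = refl
odd∧⌊/2⌋≡0⇒≡1 {suc (suc a)} _ ()

0<⇒0<⌈/2⌉ : ∀ {a} → 0 < a → 0 < ⌈ a /2⌉
0<⇒0<⌈/2⌉ {suc a} _ = s≤s z≤n

<⌈/2⌉⇒≤⌊/2⌋ : ∀ {a b} → b < ⌈ a /2⌉ → b ≤ ⌊ a /2⌋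
<⌈/2⌉⇒≤⌊/2⌋ {a} b<h with ⌈/2⌉-parity a
... | inj₁ (_ , eq) = ≤-pred (≤-trans b<h (≤-reflexive eq))
... | inj₂ (_ , eq) = <⇒≤ (≤-trans b<h (≤-reflexive eq))

<⌈/2⌉⇒+⌊/2⌋< : ∀ {a b} → b < ⌈ a /2⌉ → b + ⌊ a /2⌋ < a
<⌈/2⌉⇒+⌊/2⌋< {a} b<h = ≤-trans (+-monoˡ-≤ ⌊ a /2⌋ b<h) (≤-reflexive (⌈/2⌉+⌊/2⌋≡n a))

<⌈/2⌉⇒⌊/2⌋< : ∀ {a b} → b < ⌈ a /2⌉ → ⌊ a /2⌋ < a
<⌈/2⌉⇒⌊/2⌋< {a} {b} b<h = ≤-<-trans (m≤n+m ⌊ a /2⌋ b) (<⌈/2⌉⇒+⌊/2⌋< b<h)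

<⌈/2⌉⇒+< : ∀ {a b c} → b < ⌈ a /2⌉ → c < ⌈ a /2⌉ → b + c < a
<⌈/2⌉⇒+< {a} {b} b<h c<h = ≤-<-trans (+-monoʳ-≤ b (<⌈/2⌉⇒≤⌊/2⌋ c<h)) (<⌈/2⌉⇒+⌊/2⌋< b<h)

≤+⇒⌈/2⌉≤ : ∀ {a x} → a ≤ x + x → ⌈ a /2⌉ ≤ x
≤+⇒⌈/2⌉≤ {x = x} le = ≤-trans (⌈n/2⌉-mono le) (≤-reflexive (sym (n≡⌈n+n/2⌉ x)))

⌈/2⌉≤∧⌊/2⌋≤⇒≤+ : ∀ {a x y} → ⌈ a /2⌉ ≤ x → ⌊ a /2⌋ ≤ y → a ≤ x + y
⌈/2⌉≤∧⌊/2⌋≤⇒≤+ {a} hx fy = ≤-trans (≤-reflexive (sym (⌈/2⌉+⌊/2⌋≡n a))) (+-mono-≤ hx fy)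

infix 4 _≤ᵥ_
infixl 6 _+ᵥ_

_≤ᵥ_ : Vec ℕ k → Vec ℕ k → Set
_≤ᵥ_ = Pointwise _≤_

_+ᵥ_ : Vec ℕ k → Vec ℕ k → Vec ℕ k
_+ᵥ_ = zipWith _+_

⌈_/2⌉ᵥ ⌊_/2⌋ᵥ : Vec ℕ k → Vec ℕ k
⌈_/2⌉ᵥ = Vec.map ⌈_/2⌉
⌊_/2⌋ᵥ = Vec.map ⌊_/2⌋

0ᵥ : Vec ℕ k
0ᵥ = replicate _ 0

_≤ᵥ?_ : (β γ : Vec ℕ k) → Dec (β ≤ᵥ γ)
_≤ᵥ?_ = Pointwise.decidable _≤?_

≤ᵥ-refl : {β : Vec ℕ k} → β ≤ᵥ β
≤ᵥ-refl = Pointwise.refl ≤-refl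

≤ᵥ-antisym : {β γ : Vec ℕ k} → β ≤ᵥ γ → γ ≤ᵥ β → β ≡ γ
≤ᵥ-antisym [] [] = refl
≤ᵥ-antisym (b≤c ∷ β≤γ) (c≤b ∷ γ≤β) = cong₂ _∷_ (≤-antisym b≤c c≤b) (≤ᵥ-antisym β≤γ γ≤β)

⌈/2⌉ᵥ≤ᵥ : (as : Vec ℕ k) → ⌈ as /2⌉ᵥ ≤ᵥ as
⌈/2⌉ᵥ≤ᵥ [] = []
⌈/2⌉ᵥ≤ᵥ (a ∷ as) = ⌈n/2⌉≤n a ∷ ⌈/2⌉ᵥ≤ᵥ as

⌊/2⌋ᵥ≤ᵥ : (as : Vec ℕ k) → ⌊ as /2⌋ᵥ ≤ᵥ as
⌊/2⌋ᵥ≤ᵥ [] = []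
⌊/2⌋ᵥ≤ᵥ (a ∷ as) = ⌊n/2⌋≤n a ∷ ⌊/2⌋ᵥ≤ᵥ as

⌊/2⌋ᵥ≤ᵥ⌈/2⌉ᵥ : (as : Vec ℕ k) → ⌊ as /2⌋ᵥ ≤ᵥ ⌈ as /2⌉ᵥ
⌊/2⌋ᵥ≤ᵥ⌈/2⌉ᵥ [] = []
⌊/2⌋ᵥ≤ᵥ⌈/2⌉ᵥ (a ∷ as) = ⌊n/2⌋≤⌈n/2⌉ a ∷ ⌊/2⌋ᵥ≤ᵥ⌈/2⌉ᵥ as

≤ᵥ0ᵥ⇒≡0ᵥ : {β : Vec ℕ k} → β ≤ᵥ 0ᵥ → β ≡ 0ᵥ
≤ᵥ0ᵥ⇒≡0ᵥ [] = refl
≤ᵥ0ᵥ⇒≡0ᵥ (z≤n ∷ β≤0) = cong (0 ∷_) (≤ᵥ0ᵥ⇒≡0ᵥ β≤0)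

m≤ᵥm+ᵥn : (as γ : Vec ℕ k) → as ≤ᵥ as +ᵥ γ
m≤ᵥm+ᵥn [] [] = []
m≤ᵥm+ᵥn (a ∷ as) (c ∷ γ) = m≤m+n a c ∷ m≤ᵥm+ᵥn as γ

≤ᵥ-+ᵥ-comm : {as β γ : Vec ℕ k} → as ≤ᵥ β +ᵥ γ → as ≤ᵥ γ +ᵥ β
≤ᵥ-+ᵥ-comm {β = []} {[]} [] = []
≤ᵥ-+ᵥ-comm {as = a ∷ _} {b ∷ β} {c ∷ γ} (le ∷ les) = subst (a ≤_) (+-comm b c) le ∷ ≤ᵥ-+ᵥ-comm les

≤ᵥ+ᵥ⇒⌈/2⌉ᵥ≤ᵥ : {as β : Vec ℕ k} → as ≤ᵥ β +ᵥ β → ⌈ as /2⌉ᵥ ≤ᵥ β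
≤ᵥ+ᵥ⇒⌈/2⌉ᵥ≤ᵥ {as = []} {[]} [] = []
≤ᵥ+ᵥ⇒⌈/2⌉ᵥ≤ᵥ {as = _ ∷ _} {_ ∷ _} (le ∷ les) = ≤+⇒⌈/2⌉≤ le ∷ ≤ᵥ+ᵥ⇒⌈/2⌉ᵥ≤ᵥ les

⌈/2⌉ᵥ≤ᵥ∧⌊/2⌋ᵥ≤ᵥ⇒≤ᵥ+ᵥ : {as β γ : Vec ℕ k} → ⌈ as /2⌉ᵥ ≤ᵥ β → ⌊ as /2⌋ᵥ ≤ᵥ γ → as ≤ᵥ β +ᵥ γ
⌈/2⌉ᵥ≤ᵥ∧⌊/2⌋ᵥ≤ᵥ⇒≤ᵥ+ᵥ {as = []} {[]} {[]} [] [] = []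
⌈/2⌉ᵥ≤ᵥ∧⌊/2⌋ᵥ≤ᵥ⇒≤ᵥ+ᵥ {as = _ ∷ _} {_ ∷ _} {_ ∷ _} (hx ∷ hβ) (fy ∷ fγ) =
  ⌈/2⌉≤∧⌊/2⌋≤⇒≤+ hx fy ∷ ⌈/2⌉ᵥ≤ᵥ∧⌊/2⌋ᵥ≤ᵥ⇒≤ᵥ+ᵥ hβ fγ

-- A maximum clique of exponent vectors

interval : ℕ → ℕ → List ℕ
interval lo len = applyUpTo (lo +_) len

∈-interval⁺ : ∀ {lo len x} → lo ≤ x → x < lo + len → x ∈ interval lo len
∈-interval⁺ {lo} {len} {x} lo≤x x<lo+len =
  subst (_∈ interval lo len) (m+[n∸m]≡n lo≤x) (∈-applyUpTo⁺ (lo +_) x∸lo<len)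
  where
  x∸lo<len : x ∸ lo < len
  x∸lo<len = +-cancelˡ-< lo (x ∸ lo) len (subst (_< lo + len) (sym (m+[n∸m]≡n lo≤x)) x<lo+len)

∈-interval⁻ : ∀ {lo len x} → x ∈ interval lo len → lo ≤ x × x < lo + len
∈-interval⁻ {lo} x∈ with ∈-applyUpTo⁻ (lo +_) x∈
... | i , i<len , refl = m≤m+n lo i , +-monoʳ-< lo i<len

interval-unique : ∀ lo len → Unique (interval lo len)
interval-unique lo len = Unique.applyUpTo⁺₁ (lo +_) len (λ i<j _ → <⇒≢ (+-monoʳ-< lo i<j))

length-cartesianProductWith : ∀ {A B C : Set} (f : A → B → C) (xs : List A) (ys : List B) →
  length (cartesianProductWith f xs ys) ≡ length xs * length ys
length-cartesianProductWith f [] ys = refl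
length-cartesianProductWith f (x ∷ xs) ys = begin
  length (map (f x) ys ++ cartesianProductWith f xs ys)
    ≡⟨ length-++ (map (f x) ys) ⟩
  length (map (f x) ys) + length (cartesianProductWith f xs ys)
    ≡⟨ cong₂ _+_ (length-map (f x) ys) (length-cartesianProductWith f xs ys) ⟩
  length ys + length xs * length ys ∎
  where open ≡-Reasoning

upperBox : Vec ℕ k → List (Vec ℕ k)
upperBox [] = [ [] ]
upperBox (a ∷ as) = cartesianProductWith _∷_ (interval ⌈ a /2⌉ (suc ⌊ a /2⌋)) (upperBox as)

∈-upperBox⁺ : {as β : Vec ℕ k} → ⌈ as /2⌉ᵥ ≤ᵥ β → β ≤ᵥ as → β ∈ upperBox as
∈-upperBox⁺ [] [] = here refl
∈-upperBox⁺ {as = a ∷ as} {b ∷ β} (h≤b ∷ h≤β) (b≤a ∷ β≤as) =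
  ∈-cartesianProductWith⁺ _∷_ (∈-interval⁺ h≤b (subst (b <_) (sym (⌈/2⌉+suc⌊/2⌋≡1+n a)) (s≤s b≤a)))
                              (∈-upperBox⁺ h≤β β≤as)

∈-upperBox⁻ : {as β : Vec ℕ k} → β ∈ upperBox as → ⌈ as /2⌉ᵥ ≤ᵥ β × β ≤ᵥ as
∈-upperBox⁻ {as = []} {[]} _ = [] , []
∈-upperBox⁻ {as = a ∷ as} β∈ with ∈-cartesianProductWith⁻ _∷_ (interval ⌈ a /2⌉ (suc ⌊ a /2⌋)) (upperBox as) β∈
... | x , β , x∈ , β∈′ , refl with ∈-interval⁻ x∈ | ∈-upperBox⁻ β∈′
...   | h≤x , x<  | h≤β , β≤as = (h≤x ∷ h≤β) , (≤-pred (subst (x <_) (⌈/2⌉+suc⌊/2⌋≡1+n a) x<) ∷ β≤as)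

upperBox-unique : (as : Vec ℕ k) → Unique (upperBox as)
upperBox-unique [] = [] ∷ []
upperBox-unique (a ∷ as) =
  Unique.cartesianProductWith⁺ _∷_ ∷-injective (interval-unique ⌈ a /2⌉ (suc ⌊ a /2⌋)) (upperBox-unique as)

length-upperBox-∷ : ∀ a (as : Vec ℕ k) → length (upperBox (a ∷ as)) ≡ suc ⌊ a /2⌋ * length (upperBox as)
length-upperBox-∷ a as = trans (length-cartesianProductWith _∷_ (interval ⌈ a /2⌉ (suc ⌊ a /2⌋)) (upperBox as))
                               (cong (_* length (upperBox as)) (length-applyUpTo (⌈ a /2⌉ +_) (suc ⌊ a /2⌋)))

upperSlice : ℕ → Vec ℕ k → List (Vec ℕ (suc k))
upperSlice a as = cartesianProductWith _∷_ (interval ⌈ a /2⌉ ⌊ a /2⌋) (upperBox as)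

oddPart : Bool → ℕ → Vec ℕ k → List (Vec ℕ (suc k))
oddPart true  a as = [ ⌊ a /2⌋ ∷ as ]
oddPart false a as = []

clique : Vec ℕ k → List (Vec ℕ k)
clique [] = []
clique (a ∷ as) = upperSlice a as ++ oddPart (isOdd a) a as ++ map (a ∷_) (clique as)

∈-upperSlice⁺ : ∀ {a} {as : Vec ℕ k} {x β} →
  ⌈ a /2⌉ ≤ x → x < a → ⌈ as /2⌉ᵥ ≤ᵥ β → β ≤ᵥ as → x ∷ β ∈ upperSlice a as
∈-upperSlice⁺ {a = a} {x = x} h≤x x<a h≤β β≤as =
  ∈-cartesianProductWith⁺ _∷_ (∈-interval⁺ h≤x (subst (x <_) (sym (⌈/2⌉+⌊/2⌋≡n a)) x<a)) (∈-upperBox⁺ h≤β β≤as)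

∈-upperSlice⁻ : ∀ {a} {as : Vec ℕ k} {x β} →
  x ∷ β ∈ upperSlice a as → ⌈ a /2⌉ ≤ x × x < a × ⌈ as /2⌉ᵥ ≤ᵥ β × β ≤ᵥ as
∈-upperSlice⁻ {a = a} {as} x∷β∈ with ∈-cartesianProductWith⁻ _∷_ (interval ⌈ a /2⌉ ⌊ a /2⌋) (upperBox as) x∷β∈
... | x , β , x∈ , β∈ , refl with ∈-interval⁻ x∈ | ∈-upperBox⁻ β∈
...   | h≤x , x< | h≤β , β≤as = h≤x , subst (x <_) (⌈/2⌉+⌊/2⌋≡n a) x< , h≤β , β≤as

data CliqueMember (a : ℕ) (as : Vec ℕ k) : Vec ℕ (suc k) → Set where
  upper : ∀ {x β} → ⌈ a /2⌉ ≤ x → x < a → ⌈ as /2⌉ᵥ ≤ᵥ β → β ≤ᵥ as → CliqueMember a as (x ∷ β)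
  odd   : isOdd a ≡ true → CliqueMember a as (⌊ a /2⌋ ∷ as)
  lift  : ∀ {κ} → κ ∈ clique as → CliqueMember a as (a ∷ κ)

∈-oddPart⁻ : ∀ {o a} {as : Vec ℕ k} {κ} → κ ∈ oddPart o a as → o ≡ true × κ ≡ ⌊ a /2⌋ ∷ as
∈-oddPart⁻ {o = true} (here refl) = refl , refl

∈-clique⁻ : ∀ {a} {as : Vec ℕ k} {κ} → κ ∈ clique (a ∷ as) → CliqueMember a as κ
∈-clique⁻ {a = a} {as} {x ∷ β} κ∈ with ∈-++⁻ (upperSlice a as) κ∈
... | inj₁ κ∈U with ∈-upperSlice⁻ {a = a} {as} κ∈U
...   | h≤x , x<a , h≤β , β≤as = upper h≤x x<a h≤β β≤as
∈-clique⁻ {a = a} {as} κ∈ | inj₂ κ∈OM with ∈-++⁻ (oddPart (isOdd a) a as) κ∈OM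
... | inj₁ κ∈O with ∈-oddPart⁻ κ∈O
...   | odd-a , refl = odd odd-a
∈-clique⁻ {a = a} {as} κ∈ | inj₂ κ∈OM | inj₂ κ∈M with ∈-map⁻ (a ∷_) κ∈M
... | κ , κ∈′ , refl = lift κ∈′

∈-clique⁺ : ∀ {a} {as : Vec ℕ k} {κ} → CliqueMember a as κ → κ ∈ clique (a ∷ as)
∈-clique⁺ (upper h≤x x<a h≤β β≤as) = ∈-++⁺ˡ (∈-upperSlice⁺ h≤x x<a h≤β β≤as)
∈-clique⁺ {a = a} {as} (odd odd-a) =
  ∈-++⁺ʳ (upperSlice a as) (∈-++⁺ˡ (subst (λ o → ⌊ a /2⌋ ∷ as ∈ oddPart o a as) (sym odd-a) (here refl)))
∈-clique⁺ {a = a} {as} (lift κ∈) =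
  ∈-++⁺ʳ (upperSlice a as) (∈-++⁺ʳ (oddPart (isOdd a) a as) (∈-map⁺ (a ∷_) κ∈))

length-clique-∷ : ∀ a (as : Vec ℕ k) →
  length (clique (a ∷ as)) ≡
  ⌊ a /2⌋ * length (upperBox as) + (length (oddPart (isOdd a) a as) + length (clique as))
length-clique-∷ a as = begin
  length (upperSlice a as ++ oddPart (isOdd a) a as ++ map (a ∷_) (clique as))
    ≡⟨ length-++ (upperSlice a as) ⟩
  length (upperSlice a as) + length (oddPart (isOdd a) a as ++ map (a ∷_) (clique as))
    ≡⟨ cong (length (upperSlice a as) +_) (length-++ (oddPart (isOdd a) a as)) ⟩
  length (upperSlice a as) + (length (oddPart (isOdd a) a as) + length (map (a ∷_) (clique as)))
    ≡⟨ cong₂ (λ s m → s + (length (oddPart (isOdd a) a as) + m)) upperSlice-length (length-map (a ∷_) (clique as)) ⟩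
  ⌊ a /2⌋ * length (upperBox as) + (length (oddPart (isOdd a) a as) + length (clique as)) ∎
  where
  open ≡-Reasoning
  upperSlice-length : length (upperSlice a as) ≡ ⌊ a /2⌋ * length (upperBox as)
  upperSlice-length = trans (length-cartesianProductWith _∷_ (interval ⌈ a /2⌉ ⌊ a /2⌋) (upperBox as))
                            (cong (_* length (upperBox as)) (length-applyUpTo (⌈ a /2⌉ +_) ⌊ a /2⌋))

clique-<ᵥ : {as κ : Vec ℕ k} → κ ∈ clique as → κ ≤ᵥ as × κ ≢ as
clique-<ᵥ {as = a ∷ as} κ∈ with ∈-clique⁻ {a = a} {as} κ∈
... | upper h≤x x<a _ β≤as = (<⇒≤ x<a ∷ β≤as) , <⇒≢ x<a ∘ ∷-injectiveˡ
... | odd odd-a = (⌊n/2⌋≤n a ∷ ≤ᵥ-refl) , <⇒≢ (odd⇒⌊/2⌋< odd-a) ∘ ∷-injectiveˡ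
... | lift κ∈′ with clique-<ᵥ κ∈′
...   | κ≤as , κ≢as = (≤-refl ∷ κ≤as) , κ≢as ∘ ∷-injectiveʳ

clique-⌊/2⌋ᵥ≤ᵥ : {as κ : Vec ℕ k} → κ ∈ clique as → ⌊ as /2⌋ᵥ ≤ᵥ κ
clique-⌊/2⌋ᵥ≤ᵥ {as = a ∷ as} κ∈ with ∈-clique⁻ {a = a} {as} κ∈
... | upper h≤x _ h≤β _ = ≤-trans (⌊n/2⌋≤⌈n/2⌉ a) h≤x ∷ Pointwise.trans ≤-trans (⌊/2⌋ᵥ≤ᵥ⌈/2⌉ᵥ as) h≤β
... | odd _ = ≤-refl ∷ ⌊/2⌋ᵥ≤ᵥ as
... | lift κ∈′ = ⌊n/2⌋≤n a ∷ clique-⌊/2⌋ᵥ≤ᵥ κ∈′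

clique-covers : {as κ κ′ : Vec ℕ k} → κ ∈ clique as → κ′ ∈ clique as → κ ≢ κ′ → as ≤ᵥ κ +ᵥ κ′
clique-covers {as = a ∷ as} κ∈ κ′∈ κ≢κ′ with ∈-clique⁻ {a = a} {as} κ∈ | ∈-clique⁻ {a = a} {as} κ′∈
... | upper h≤x _ h≤β _ | _ = ⌈/2⌉ᵥ≤ᵥ∧⌊/2⌋ᵥ≤ᵥ⇒≤ᵥ+ᵥ (h≤x ∷ h≤β) (clique-⌊/2⌋ᵥ≤ᵥ κ′∈)
... | _ | upper h≤x _ h≤β _ = ≤ᵥ-+ᵥ-comm (⌈/2⌉ᵥ≤ᵥ∧⌊/2⌋ᵥ≤ᵥ⇒≤ᵥ+ᵥ (h≤x ∷ h≤β) (clique-⌊/2⌋ᵥ≤ᵥ κ∈))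
... | odd _ | odd _ = ⊥-elim (κ≢κ′ refl)
... | odd _ | lift {κ} _ = m≤n+m a ⌊ a /2⌋ ∷ m≤ᵥm+ᵥn as κ
... | lift {κ} _ | odd _ = m≤m+n a ⌊ a /2⌋ ∷ ≤ᵥ-+ᵥ-comm (m≤ᵥm+ᵥn as κ)
... | lift κ∈″ | lift κ′∈″ = m≤m+n a a ∷ clique-covers κ∈″ κ′∈″ (κ≢κ′ ∘ cong (a ∷_))

oddPart-unique : ∀ o a (as : Vec ℕ k) → Unique (oddPart o a as)
oddPart-unique true  a as = [] ∷ []
oddPart-unique false a as = []

clique-unique : (as : Vec ℕ k) → Unique (clique as)
clique-unique [] = []
clique-unique (a ∷ as) =
  Unique.++⁺ (Unique.cartesianProductWith⁺ _∷_ ∷-injective (interval-unique ⌈ a /2⌉ ⌊ a /2⌋) (upperBox-unique as))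
             (Unique.++⁺ (oddPart-unique (isOdd a) a as) (Unique.map⁺ ∷-injectiveʳ (clique-unique as)) oddPart∩lifted)
             upperSlice∩rest
  where
  oddPart∩lifted : ∀ {v} → ¬ (v ∈ oddPart (isOdd a) a as × v ∈ map (a ∷_) (clique as))
  oddPart∩lifted (v∈O , v∈M) with ∈-oddPart⁻ v∈O | ∈-map⁻ (a ∷_) v∈M
  ... | odd-a , refl | _ , _ , eq = <⇒≢ (odd⇒⌊/2⌋< odd-a) (∷-injectiveˡ eq)

  upperSlice∩rest : ∀ {v} → ¬ (v ∈ upperSlice a as × v ∈ oddPart (isOdd a) a as ++ map (a ∷_) (clique as))
  upperSlice∩rest {x ∷ β} (v∈U , v∈OM) with ∈-upperSlice⁻ {a = a} {as} v∈U | ∈-++⁻ (oddPart (isOdd a) a as) v∈OM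
  ... | h≤x , x<a , _ | inj₁ v∈O with ∈-oddPart⁻ v∈O
  ...   | odd-a , refl = <⇒≱ (odd⇒⌊/2⌋<⌈/2⌉ odd-a) h≤x
  upperSlice∩rest {x ∷ β} (v∈U , v∈OM) | h≤x , x<a , _ | inj₂ v∈M with ∈-map⁻ (a ∷_) v∈M
  ... | _ , _ , refl = <-irrefl refl x<a

0ᵥ∈clique⇒≤ᵥ-trivial : {as κ β : Vec ℕ k} → κ ∈ clique as → κ ≡ 0ᵥ → β ≤ᵥ as → β ≡ 0ᵥ ⊎ β ≡ as
0ᵥ∈clique⇒≤ᵥ-trivial {as = a ∷ as} {β = b ∷ β} κ∈ κ≡0 (b≤a ∷ β≤as) with ∈-clique⁻ {a = a} {as} κ∈
... | upper h≤x x<a _ _ rewrite ∷-injectiveˡ κ≡0 = ⊥-elim (<⇒≱ (0<⇒0<⌈/2⌉ x<a) h≤x)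
... | odd odd-a with odd∧⌊/2⌋≡0⇒≡1 odd-a (∷-injectiveˡ κ≡0) | ∷-injectiveʳ κ≡0
...   | refl | refl with ≤ᵥ0ᵥ⇒≡0ᵥ β≤as | m≤n⇒m<n∨m≡n b≤a
...     | refl | inj₁ b<1 = inj₁ (cong (_∷ β) (n<1⇒n≡0 b<1))
...     | refl | inj₂ refl = inj₂ refl
0ᵥ∈clique⇒≤ᵥ-trivial {as = a ∷ as} {β = b ∷ β} κ∈ κ≡0 (b≤a ∷ β≤as) | lift κ∈′ with ∷-injective κ≡0
... | refl , κ′≡0 with b≤a
...   | z≤n = Sum.map (cong (0 ∷_)) (cong (0 ∷_)) (0ᵥ∈clique⇒≤ᵥ-trivial κ∈′ κ′≡0 β≤as)

-- Colouring exponent vectors by clique vertices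

colour : Vec ℕ k → Vec ℕ k → Vec ℕ k
colour [] [] = []
colour (a ∷ as) (b ∷ β) with b <? ⌈ a /2⌉ | b <? a ×-dec ⌈ as /2⌉ᵥ ≤ᵥ? β
... | yes _ | _     = ⌊ a /2⌋ ∷ as
... | no _  | yes _ = b ∷ β
... | no _  | no _  = a ∷ colour as β

⌊/2⌋∷-member : ∀ {a b} {as : Vec ℕ k} → b < ⌈ a /2⌉ → CliqueMember a as (⌊ a /2⌋ ∷ as)
⌊/2⌋∷-member {a = a} b<h with ⌈/2⌉-parity a
... | inj₁ (odd-a , _) = odd odd-a
... | inj₂ (_ , h≡f) = upper (≤-reflexive h≡f) (<⌈/2⌉⇒⌊/2⌋< b<h) (⌈/2⌉ᵥ≤ᵥ _) ≤ᵥ-refl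

colour-∈ : {as β : Vec ℕ k} → β ≤ᵥ as → β ≢ as → colour as β ∈ clique as
colour-∈ {as = []} {[]} [] β≢as = ⊥-elim (β≢as refl)
colour-∈ {as = a ∷ as} {b ∷ β} (b≤a ∷ β≤as) bβ≢as with b <? ⌈ a /2⌉ | b <? a ×-dec ⌈ as /2⌉ᵥ ≤ᵥ? β
... | yes b<h | _               = ∈-clique⁺ (⌊/2⌋∷-member b<h)
... | no b≮h  | yes (b<a , h≤β) = ∈-clique⁺ (upper (≮⇒≥ b≮h) b<a h≤β β≤as)
... | no _    | no ¬slice       = ∈-clique⁺ (lift (colour-∈ β≤as β≢as))
  where
  β≢as : β ≢ as
  β≢as refl with m≤n⇒m<n∨m≡n b≤a
  ... | inj₁ b<a = ¬slice (b<a , ⌈/2⌉ᵥ≤ᵥ as)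
  ... | inj₂ refl = bβ≢as refl

colour-injective : {as β γ : Vec ℕ k} → β ≤ᵥ as → γ ≤ᵥ as → as ≤ᵥ β +ᵥ γ → colour as β ≡ colour as γ → β ≡ γ
colour-injective {as = []} {[]} {[]} _ _ _ _ = refl
colour-injective {as = a ∷ as} {b ∷ β} {c ∷ γ} (b≤a ∷ β≤as) (c≤a ∷ γ≤as) (a≤b+c ∷ as≤β+γ) eq
  with b <? ⌈ a /2⌉ | b <? a ×-dec ⌈ as /2⌉ᵥ ≤ᵥ? β | c <? ⌈ a /2⌉ | c <? a ×-dec ⌈ as /2⌉ᵥ ≤ᵥ? γ
... | yes b<h | _ | yes c<h | _ = ⊥-elim (<⇒≱ (<⌈/2⌉⇒+< b<h c<h) a≤b+c)
... | yes b<h | _ | no _ | yes _ =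
  ⊥-elim (<⇒≱ (<⌈/2⌉⇒+⌊/2⌋< b<h) (subst (λ z → a ≤ b + z) (sym (∷-injectiveˡ eq)) a≤b+c))
... | yes b<h | _ | no _ | no _ = ⊥-elim (<⇒≢ (<⌈/2⌉⇒⌊/2⌋< b<h) (∷-injectiveˡ eq))
... | no _ | yes _ | yes c<h | _ =
  ⊥-elim (<⇒≱ (<⌈/2⌉⇒+⌊/2⌋< c<h) (subst (λ z → a ≤ c + z) (∷-injectiveˡ eq) (subst (a ≤_) (+-comm b c) a≤b+c)))
... | no _ | no _ | yes c<h | _ = ⊥-elim (<⇒≢ (<⌈/2⌉⇒⌊/2⌋< c<h) (sym (∷-injectiveˡ eq)))
... | no _ | yes _ | no _ | yes _ = eq
... | no _ | yes (b<a , _) | no _ | no _ = ⊥-elim (<⇒≢ b<a (∷-injectiveˡ eq))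
... | no _ | no _ | no _ | yes (c<a , _) = ⊥-elim (<⇒≢ c<a (sym (∷-injectiveˡ eq)))
-- Equal tails β = γ with α ≤ β + γ put β in the upper box, so neither head can lie below a.
... | no _ | no ¬slice-b | no _ | no ¬slice-c with colour-injective β≤as γ≤as as≤β+γ (∷-injectiveʳ eq)
...   | refl = cong₂ _∷_ (trans (b≡a ¬slice-b b≤a) (sym (b≡a ¬slice-c c≤a))) refl
  where
  h≤β : ⌈ as /2⌉ᵥ ≤ᵥ β
  h≤β = ≤ᵥ+ᵥ⇒⌈/2⌉ᵥ≤ᵥ as≤β+γ
  b≡a : ∀ {x} → ¬ (x < a × ⌈ as /2⌉ᵥ ≤ᵥ β) → x ≤ a → x ≡ a
  b≡a ¬slice x≤a = ≤∧≮⇒≡ x≤a (λ x<a → ¬slice (x<a , h≤β))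

-- Divisors of products of prime powers

prime⇒≢1 : ∀ {p} → Prime p → p ≢ 1
prime⇒≢1 pp = nonTrivial⇒≢1 {{prime⇒nonTrivial pp}}

^-monoʳ-∣ : ∀ p {b c} → b ≤ c → p ^ b ∣ p ^ c
^-monoʳ-∣ p z≤n = 1∣ _
^-monoʳ-∣ p (s≤s b≤c) = *-monoʳ-∣ p (^-monoʳ-∣ p b≤c)

prime∣^⇒≡ : ∀ {p q} b → Prime p → Prime q → p ∣ q ^ b → p ≡ q
prime∣^⇒≡ zero pp _ p∣1 = ⊥-elim (prime⇒≢1 pp (∣1⇒≡1 p∣1))
prime∣^⇒≡ {q = q} (suc b) pp pq p∣q^[1+b] with euclidsLemma q (q ^ b) pp p∣q^[1+b]
... | inj₂ p∣q^b = prime∣^⇒≡ b pp pq p∣q^b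
... | inj₁ p∣q with prime⇒irreducible pq p∣q
...   | inj₁ p≡1 = ⊥-elim (prime⇒≢1 pp p≡1)
...   | inj₂ p≡q = p≡q

prime∤⇒coprime : ∀ {p m} → Prime p → ¬ p ∣ m → Coprime m p
prime∤⇒coprime pp p∤m (d∣m , d∣p) with prime⇒irreducible pp d∣p
... | inj₁ d≡1 = d≡1
... | inj₂ refl = ⊥-elim (p∤m d∣m)

coprime-∣^*⇒∣ : ∀ {m p o} → Coprime m p → ∀ c → m ∣ p ^ c * o → m ∣ o
coprime-∣^*⇒∣ {m} {o = o} cop zero m∣ = subst (m ∣_) (*-identityˡ o) m∣
coprime-∣^*⇒∣ {m} {p} {o} cop (suc c) m∣ =
  coprime-∣^*⇒∣ cop c (coprime-divisor cop (subst (m ∣_) (*-assoc p (p ^ c) o) m∣))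

^*∣^*⇒≤ : ∀ {p m m′} → Prime p → ¬ p ∣ m → ¬ p ∣ m′ → ∀ b c → p ^ b * m ∣ p ^ c * m′ → b ≤ c × m ∣ m′
^*∣^*⇒≤ {m = m} pp p∤m _ zero c div =
  z≤n , coprime-∣^*⇒∣ (prime∤⇒coprime pp p∤m) c (subst (_∣ _) (*-identityˡ m) div)
^*∣^*⇒≤ {p} {m} {m′} pp _ p∤m′ (suc b) zero div =
  ⊥-elim (p∤m′ (subst (p ∣_) (*-identityˡ m′) (∣-trans (∣m⇒∣m*n m (m∣m*n (p ^ b))) div)))
^*∣^*⇒≤ {p} {m} {m′} pp p∤m p∤m′ (suc b) (suc c) div =
  Product.map₁ s≤s (^*∣^*⇒≤ pp p∤m p∤m′ b c (*-cancelˡ-∣ p {{prime⇒nonZero pp}} p*∣p*))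
  where
  p*∣p* : p * (p ^ b * m) ∣ p * (p ^ c * m′)
  p*∣p* = subst₂ _∣_ (*-assoc p (p ^ b) m) (*-assoc p (p ^ c) m′) div

∣^*⇒ : ∀ {p} → Prime p → ∀ a {d m} → d ∣ p ^ a * m → ∃₂ λ b d′ → b ≤ a × d′ ∣ m × d ≡ p ^ b * d′
∣^*⇒ pp zero {d} {m} d∣ = 0 , d , z≤n , subst (d ∣_) (*-identityˡ m) d∣ , sym (*-identityˡ d)
∣^*⇒ {p} pp (suc a) {d} {m} d∣ with p ∣? d
... | no p∤d with ∣^*⇒ pp a (coprime-divisor (prime∤⇒coprime pp p∤d) (subst (d ∣_) (*-assoc p (p ^ a) m) d∣))
...   | b , d′ , b≤a , d′∣m , d≡ = b , d′ , m≤n⇒m≤1+n b≤a , d′∣m , d≡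
∣^*⇒ {p} pp (suc a) {d} {m} d∣ | yes (divides q refl)
  with ∣^*⇒ pp a (*-cancelˡ-∣ p {{prime⇒nonZero pp}} (subst₂ _∣_ (*-comm q p) (*-assoc p (p ^ a) m) d∣))
... | b , d′ , b≤a , d′∣m , q≡ = suc b , d′ , s≤s b≤a , d′∣m , (begin
  q * p             ≡⟨ *-comm q p ⟩
  p * q             ≡⟨ cong (p *_) q≡ ⟩
  p * (p ^ b * d′)  ≡⟨ *-assoc p (p ^ b) d′ ⟨
  p ^ suc b * d′    ∎)
  where open ≡-Reasoning

monomial : (fs : List (ℕ × ℕ)) → Vec ℕ (length fs) → ℕ
monomial [] [] = 1
monomial ((p , _) ∷ fs) (b ∷ β) = p ^ b * monomial fs β

exponents : (fs : List (ℕ × ℕ)) → Vec ℕ (length fs)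
exponents [] = []
exponents ((_ , a) ∷ fs) = a ∷ exponents fs

PrimeBases : List (ℕ × ℕ) → Set
PrimeBases = All (Prime ∘ proj₁)

product≡monomial-exponents : ∀ fs → product (map (λ pa → proj₁ pa ^ proj₂ pa) fs) ≡ monomial fs (exponents fs)
product≡monomial-exponents [] = refl
product≡monomial-exponents ((p , a) ∷ fs) = cong (p ^ a *_) (product≡monomial-exponents fs)

monomial-nonZero : ∀ {fs} → PrimeBases fs → ∀ β → NonZero (monomial fs β)
monomial-nonZero [] [] = _
monomial-nonZero {(p , _) ∷ fs} (pp ∷ ps) (b ∷ β) =
  m*n≢0 (p ^ b) (monomial fs β) {{m^n≢0 p b {{prime⇒nonZero pp}}}} {{monomial-nonZero ps β}}

monomial-0ᵥ : ∀ fs → monomial fs 0ᵥ ≡ 1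
monomial-0ᵥ [] = refl
monomial-0ᵥ (_ ∷ fs) = trans (*-identityˡ _) (monomial-0ᵥ fs)

monomial-+ᵥ : ∀ fs (β γ : Vec ℕ (length fs)) → monomial fs (β +ᵥ γ) ≡ monomial fs β * monomial fs γ
monomial-+ᵥ [] [] [] = refl
monomial-+ᵥ ((p , _) ∷ fs) (b ∷ β) (c ∷ γ) = begin
  p ^ (b + c) * monomial fs (β +ᵥ γ)                  ≡⟨ cong₂ _*_ (^-distribˡ-+-* p b c) (monomial-+ᵥ fs β γ) ⟩
  (p ^ b * p ^ c) * (monomial fs β * monomial fs γ)   ≡⟨ [m*n]*[o*p]≡[m*o]*[n*p] (p ^ b) (p ^ c) _ _ ⟩
  (p ^ b * monomial fs β) * (p ^ c * monomial fs γ)   ∎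
  where open ≡-Reasoning

monomial-mono : ∀ fs {β γ : Vec ℕ (length fs)} → β ≤ᵥ γ → monomial fs β ∣ monomial fs γ
monomial-mono [] [] = ∣-refl
monomial-mono ((p , _) ∷ fs) (b≤c ∷ β≤γ) = *-pres-∣ (^-monoʳ-∣ p b≤c) (monomial-mono fs β≤γ)

prime∤monomial : ∀ {p fs} → Prime p → PrimeBases fs → All (p ≢_) (map proj₁ fs) → ∀ β → ¬ p ∣ monomial fs β
prime∤monomial pp [] [] [] p∣1 = prime⇒≢1 pp (∣1⇒≡1 p∣1)
prime∤monomial {fs = (q , _) ∷ fs} pp (pq ∷ ps) (p≢q ∷ p∉) (b ∷ β) p∣
  with euclidsLemma (q ^ b) (monomial fs β) pp p∣
... | inj₁ p∣q^b = p≢q (prime∣^⇒≡ b pp pq p∣q^b)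
... | inj₂ p∣rest = prime∤monomial pp ps p∉ β p∣rest

monomial-∣⇒≤ᵥ : ∀ {fs} → PrimeBases fs → Unique (map proj₁ fs) → ∀ β γ → monomial fs β ∣ monomial fs γ → β ≤ᵥ γ
monomial-∣⇒≤ᵥ [] [] [] [] _ = []
monomial-∣⇒≤ᵥ (pp ∷ ps) (p∉ ∷ distinct) (b ∷ β) (c ∷ γ) div
  with ^*∣^*⇒≤ pp (prime∤monomial pp ps p∉ β) (prime∤monomial pp ps p∉ γ) b c div
... | b≤c , rest∣ = b≤c ∷ monomial-∣⇒≤ᵥ ps distinct β γ rest∣

monomial-injective : ∀ {fs} → PrimeBases fs → Unique (map proj₁ fs) →
  ∀ {β γ} → monomial fs β ≡ monomial fs γ → β ≡ γ
monomial-injective ps distinct {β} {γ} eq =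
  ≤ᵥ-antisym (monomial-∣⇒≤ᵥ ps distinct β γ (∣-reflexive eq))
             (monomial-∣⇒≤ᵥ ps distinct γ β (∣-reflexive (sym eq)))

∣monomial⇒ : ∀ {fs d} → PrimeBases fs → ∀ γ → d ∣ monomial fs γ →
  Σ (Vec ℕ (length fs)) λ β → β ≤ᵥ γ × d ≡ monomial fs β
∣monomial⇒ [] [] d∣1 = [] , [] , ∣1⇒≡1 d∣1
∣monomial⇒ (pp ∷ ps) (c ∷ γ) d∣ with ∣^*⇒ pp c d∣
... | b , d′ , b≤c , d′∣ , refl with ∣monomial⇒ ps γ d′∣
...   | β , β≤γ , refl = b ∷ β , b≤c ∷ β≤γ , refl

allPairs-lookup : ∀ {A : Set} {R : A → A → Set} {xs : List A} → AllPairs R xs →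
  ∀ {i j} → i Fin.< j → R (lookup xs i) (lookup xs j)
allPairs-lookup (Rx ∷ _) {zero} {suc j} _ = All.lookup Rx (∈-lookup j)
allPairs-lookup (_ ∷ Rxs) {suc i} {suc j} (s≤s i<j) = allPairs-lookup Rxs i<j

allPairs-∈ : ∀ {A : Set} {R : A → A → Set} {xs : List A} → Unique xs →
  (∀ {x y} → x ∈ xs → y ∈ xs → x ≢ y → R x y) → AllPairs R xs
allPairs-∈ [] _ = []
allPairs-∈ (x∉xs ∷ unique) R-∈ =
  All.tabulate (λ y∈xs → R-∈ (here refl) (there y∈xs) (All.lookup x∉xs y∈xs)) ∷
  allPairs-∈ unique (λ x∈ y∈ → R-∈ (there x∈) (there y∈))

clique-length≤colours : ∀ {n k c vs} → IsProperColouring n k c → IsClique n vs → length vs ≤ k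
clique-length≤colours {k = k} {c} {vs} proper (vertices , _ , adjacent) with length vs ≤? k
... | yes le = le
... | no nle with pigeonhole (≰⇒> nle) (c ∘ lookup vs)
...   | i , j , i<j , same =
  ⊥-elim (proper _ _ (vertex i) (vertex j) (allPairs-lookup adjacent i<j) same)
  where
  vertex : ∀ i → ProperDivisor _ (lookup vs i)
  vertex i = All.lookup vertices (∈-lookup i)

clique∧colouring⇒χ≡ω : ∀ {n K c} → IsClique n K → IsProperColouring n (length K) c →
  IsChromaticNumber n (length K) × IsCliqueNumber n (length K)
clique∧colouring⇒χ≡ω {c = c} isClique proper =
  ((c , proper) , λ _ (_ , proper′) → clique-length≤colours proper′ isClique) ,
  ((_ , isClique , refl) , λ _ isClique′ → clique-length≤colours proper isClique′)

properDivisor? : ∀ n d → Dec (ProperDivisor n d)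
properDivisor? n d = 1 <? d ×-dec d <? n ×-dec d ∣? n

composite⇒vertex : ∀ {m} → Composite m → Σ ℕ (ProperDivisor m)
composite⇒vertex c = divisor , nonTrivial⇒n>1 divisor , divisor-< , divisor-∣
  where open _HasNonTrivialDivisorLessThan_ c

module _ {n} {K : List ℕ} (ρ : ℕ → ℕ) (ρ∈K : ∀ {v} → ProperDivisor n v → ρ v ∈ K)
         {w} (w-vertex : ProperDivisor n w) where

  colourBy : ℕ → Fin (length K)
  colourBy v with properDivisor? n v
  ... | yes v-vertex = index (ρ∈K v-vertex)
  ... | no _ = index (ρ∈K w-vertex)

  lookup-colourBy : ∀ {v} → ProperDivisor n v → ρ v ≡ lookup K (colourBy v)
  lookup-colourBy {v} v-vertex with properDivisor? n v
  ... | yes v-vertex′ = lookup-index (ρ∈K v-vertex′)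
  ... | no ¬vertex = ⊥-elim (¬vertex v-vertex)

  colourBy-proper : (∀ {u v} → ProperDivisor n u → ProperDivisor n v → Adj n u v → ρ u ≢ ρ v) →
    IsProperColouring n (length K) colourBy
  colourBy-proper ρ-proper u v u-vertex v-vertex adj same =
    ρ-proper u-vertex v-vertex adj
      (trans (lookup-colourBy u-vertex) (trans (cong (lookup K) same) (sym (lookup-colourBy v-vertex))))

-- Υₙ in exponent coordinates

module _ {fs : List (ℕ × ℕ)} (primes : PrimeBases fs) (distinct : Unique (map proj₁ fs)) where

  private
    N = monomial fs (exponents fs)
    instance
      N≢0 : NonZero N
      N≢0 = monomial-nonZero primes (exponents fs)

  exponentsOf : ℕ → Vec ℕ (length fs)
  exponentsOf d with d ∣? N
  ... | yes d∣N = proj₁ (∣monomial⇒ primes (exponents fs) d∣N)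
  ... | no _ = 0ᵥ

  exponentsOf-vertex : ∀ {d} → ProperDivisor N d →
    exponentsOf d ≤ᵥ exponents fs × exponentsOf d ≢ exponents fs × exponentsOf d ≢ 0ᵥ ×
    d ≡ monomial fs (exponentsOf d)
  exponentsOf-vertex {d} (1<d , d<N , d∣N) with d ∣? N
  ... | no d∤N = ⊥-elim (d∤N d∣N)
  ... | yes d∣N′ with ∣monomial⇒ primes (exponents fs) d∣N′
  ...   | β , β≤as , refl =
    β≤as , (λ { refl → <-irrefl refl d<N }) , (λ { refl → <⇒≢ 1<d (sym (monomial-0ᵥ fs)) }) , refl

  monomial-vertex : ∀ {β} → β ≤ᵥ exponents fs → β ≢ exponents fs → β ≢ 0ᵥ → ProperDivisor N (monomial fs β)
  monomial-vertex {β} β≤as β≢as β≢0 =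
    ≤∧≢⇒< (>-nonZero⁻¹ _ {{monomial-nonZero primes β}})
          (λ 1≡ → β≢0 (monomial-injective primes distinct (trans (sym 1≡) (sym (monomial-0ᵥ fs))))) ,
    ≤∧≢⇒< (∣⇒≤ β∣N) (β≢as ∘ monomial-injective primes distinct) ,
    β∣N
    where
    β∣N = monomial-mono fs β≤as

  private
    K = map (monomial fs) (clique (exponents fs))

  -- The only use of compositeness: for prime n the clique is {0ᵥ}, i.e. the non-vertex 1.
  0ᵥ∉clique : Composite N → 0ᵥ ∉ clique (exponents fs)
  0ᵥ∉clique comp 0∈ with composite⇒vertex comp
  ... | d , d-vertex with exponentsOf-vertex d-vertex
  ...   | δ≤as , δ≢as , δ≢0 , _ with 0ᵥ∈clique⇒≤ᵥ-trivial 0∈ refl δ≤as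
  ...     | inj₁ δ≡0 = δ≢0 δ≡0
  ...     | inj₂ δ≡as = δ≢as δ≡as

  monomial-clique : Composite N → IsClique N K
  monomial-clique comp =
    All.map⁺ (All.tabulate vertex) ,
    Unique.map⁺ (monomial-injective primes distinct) (clique-unique (exponents fs)) ,
    AllPairs.map⁺ (allPairs-∈ (clique-unique (exponents fs)) adjacent)
    where
    vertex : ∀ {κ} → κ ∈ clique (exponents fs) → ProperDivisor N (monomial fs κ)
    vertex κ∈ = monomial-vertex (proj₁ (clique-<ᵥ κ∈)) (proj₂ (clique-<ᵥ κ∈)) (λ { refl → 0ᵥ∉clique comp κ∈ })
    adjacent : ∀ {κ κ′} → κ ∈ clique (exponents fs) → κ′ ∈ clique (exponents fs) → κ ≢ κ′ →
      Adj N (monomial fs κ) (monomial fs κ′)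
    adjacent κ∈ κ′∈ κ≢κ′ =
      κ≢κ′ ∘ monomial-injective primes distinct ,
      subst (N ∣_) (monomial-+ᵥ fs _ _) (monomial-mono fs (clique-covers κ∈ κ′∈ κ≢κ′))

  cliqueColour : ℕ → ℕ
  cliqueColour d = monomial fs (colour (exponents fs) (exponentsOf d))

  cliqueColour-∈ : ∀ {d} → ProperDivisor N d → cliqueColour d ∈ K
  cliqueColour-∈ d-vertex with exponentsOf-vertex d-vertex
  ... | δ≤as , δ≢as , _ = ∈-map⁺ (monomial fs) (colour-∈ δ≤as δ≢as)

  cliqueColour-proper : ∀ {u v} → ProperDivisor N u → ProperDivisor N v → Adj N u v →
    cliqueColour u ≢ cliqueColour v
  cliqueColour-proper {u} {v} u-vertex v-vertex (u≢v , N∣uv) same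
    with exponentsOf-vertex u-vertex | exponentsOf-vertex v-vertex
  ... | β≤as , _ , _ , u≡ | γ≤as , _ , _ , v≡ =
    u≢v (trans u≡ (trans (cong (monomial fs) β≡γ) (sym v≡)))
    where
    as≤β+γ : exponents fs ≤ᵥ exponentsOf u +ᵥ exponentsOf v
    as≤β+γ = monomial-∣⇒≤ᵥ primes distinct _ _
      (subst (N ∣_) (trans (cong₂ _*_ u≡ v≡) (sym (monomial-+ᵥ fs _ _))) N∣uv)
    β≡γ : exponentsOf u ≡ exponentsOf v
    β≡γ = colour-injective β≤as γ≤as as≤β+γ (monomial-injective primes distinct same)

  χ∧ω-monomial : Composite N → IsChromaticNumber N (length K) × IsCliqueNumber N (length K)
  χ∧ω-monomial comp with composite⇒vertex comp
  ... | _ , w-vertex =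
    clique∧colouring⇒χ≡ω (monomial-clique comp)
      (colourBy-proper cliqueColour cliqueColour-∈ w-vertex cliqueColour-proper)

length-upperBox : ∀ fs → length (upperBox (exponents fs)) ≡ productPart fs
length-upperBox [] = refl
length-upperBox ((p , a) ∷ fs) =
  trans (length-upperBox-∷ a (exponents fs)) (cong₂ _*_ (sym (factor≡suc⌊/2⌋ a)) (length-upperBox fs))

numOdd-∷ : ∀ p a fs → numOdd ((p , a) ∷ fs) ≡ length (oddPart (isOdd a) a (exponents fs)) + numOdd fs
numOdd-∷ p a fs with isOdd a
... | true = refl
... | false = refl

length-clique+1 : ∀ fs → length (clique (exponents fs)) + 1 ≡ productPart fs + numOdd fs
length-clique+1 [] = refl
length-clique+1 ((p , a) ∷ fs) = begin
  length (clique (a ∷ exponents fs)) + 1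
    ≡⟨ cong (_+ 1) (length-clique-∷ a (exponents fs)) ⟩
  ⌊ a /2⌋ * length (upperBox (exponents fs)) + (o + L) + 1
    ≡⟨ cong (λ P → ⌊ a /2⌋ * P + (o + L) + 1) (length-upperBox fs) ⟩
  ⌊ a /2⌋ * Q + (o + L) + 1    ≡⟨ regroup ⌊ a /2⌋ Q o L ⟩
  ⌊ a /2⌋ * Q + o + (L + 1)    ≡⟨ cong (⌊ a /2⌋ * Q + o +_) (length-clique+1 fs) ⟩
  ⌊ a /2⌋ * Q + o + (Q + l)    ≡⟨ collect ⌊ a /2⌋ Q o l ⟩
  suc ⌊ a /2⌋ * Q + (o + l)    ≡⟨ cong₂ _+_ (cong (_* Q) (sym (factor≡suc⌊/2⌋ a))) (sym (numOdd-∷ p a fs)) ⟩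
  factor a * Q + numOdd ((p , a) ∷ fs) ∎
  where
  open ≡-Reasoning
  Q = productPart fs
  l = numOdd fs
  o = length (oddPart (isOdd a) a (exponents fs))
  L = length (clique (exponents fs))
  regroup : ∀ f q o L → f * q + (o + L) + 1 ≡ f * q + o + (L + 1)
  regroup = solve-∀
  collect : ∀ f q o l → f * q + o + (q + l) ≡ suc f * q + (o + l)
  collect = solve-∀

proposition5p3 : (n : ℕ) → Composite n
    → ¬ (Σ ℕ (λ p → Prime p × n ≡ p * p))
    → (fs : List (ℕ × ℕ)) → IsPrimeFactorization n fs
    → IsChromaticNumber n (productPart fs + numOdd fs ∸ 1)
      × IsCliqueNumber n (productPart fs + numOdd fs ∸ 1)
proposition5p3 n comp _ fs (primes , _ , distinct , n≡∏) =
  subst₂ (λ m ω → IsChromaticNumber m ω × IsCliqueNumber m ω) (sym n≡N) ω≡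
         (χ∧ω-monomial primes distinct (subst Composite n≡N comp))
  where
  n≡N : n ≡ monomial fs (exponents fs)
  n≡N = trans n≡∏ (product≡monomial-exponents fs)
  ω≡ : length (map (monomial fs) (clique (exponents fs))) ≡ productPart fs + numOdd fs ∸ 1
  ω≡ = begin
    length (map (monomial fs) (clique (exponents fs))) ≡⟨ length-map (monomial fs) (clique (exponents fs)) ⟩
    length (clique (exponents fs))                     ≡⟨ m+n∸n≡m (length (clique (exponents fs))) 1 ⟨
    length (clique (exponents fs)) + 1 ∸ 1             ≡⟨ cong (_∸ 1) (length-clique+1 fs) ⟩
    productPart fs + numOdd fs ∸ 1                     ∎
    where open ≡-Reasoning
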